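{- Let $\omega=e^{2\pi i/3}$ and, for $\alpha\in\mathbb C$ and $n=0,1,2,\dots$, define $$B_n^\alpha(t)=\frac1{n!}\sum_{k=0}^n\frac{(\omega t)_k(\omega^2t)_k(\alpha+t)_{n-k}(\alpha-t+k)_{n-k}}{k!\,(n-k)!}.$$ Then $B_n^{1-n-\alpha}(t)=B_n^\alpha(t)$ for all $n\ge0$ and $\alpha\in\mathbb C$.
   Context: $(a)_n=a(a+1)\cdots(a+n-1)$ (with $(a)_0=1$) is the Pochhammer symbol. -}

module Defs where

open import Level using (_⊔_; suc)
open import Algebra.Bundles using (CommutativeRing)
open import Data.Nat as ℕ using (ℕ; zero; _∸_)
open import Data.Nat.Base using (_!; NonZero)
open import Data.Nat.Properties using (_!≢0)
open import Data.Product using (Σ; proj₁)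
open import Relation.Nullary using (¬_)

-- A field of characteristic zero, given as a commutative ring in which
-- every nonzero element has a multiplicative inverse, and no positive
-- natural number n·1 is zero.  (ℂ is an instance.)
-- canonical image of a natural number in a ring: n ↦ 1 + 1 + ... + 1
ι : ∀ {c ℓ} (R : CommutativeRing c ℓ) → ℕ → CommutativeRing.Carrier R
ι R ℕ.zero = CommutativeRing.0# R
ι R (ℕ.suc n) = CommutativeRing._+_ R (CommutativeRing.1# R) (ι R n)

record CharZeroField (c ℓ : Level.Level) : Set (Level.suc (c ⊔ ℓ)) where
  field
    commRing : CommutativeRing c ℓ
  open CommutativeRing commRing public hiding (zero)
  field
    inverse  : ∀ x → ¬ (x ≈ 0#) → Σ Carrier (λ y → x * y ≈ 1#)
    charZero : ∀ n → .{{NonZero n}} → ¬ (ι commRing n ≈ 0#)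

  inv! : ℕ → Carrier
  inv! n = proj₁ (inverse (ι commRing (n !)) (charZero (n !) {{n !≢0}}))

  poch : Carrier → ℕ → Carrier
  poch a ℕ.zero = 1#
  poch a (ℕ.suc k) = poch a k * (a + ι commRing k)

  sumTo : (ℕ → Carrier) → ℕ → Carrier
  sumTo f ℕ.zero = f zero
  sumTo f (ℕ.suc n) = sumTo f n + f (ℕ.suc n)

  B : (ω : Carrier) (n : ℕ) (α t : Carrier) → Carrier
  B ω n α t = inv! n * sumTo term n
    where
    term : ℕ → Carrier
    term k = poch (ω * t) k * poch ((ω * ω) * t) k
             * poch (α + t) (n ∸ k) * poch ((α - t) + ι commRing k) (n ∸ k)
             * (inv! k * inv! (n ∸ k))

module Submission where

-- The reflection B_n^{1-n-α}(t) = B_n^α(t) holds summand by summand, and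
-- needs nothing about ω: write m = n - k.  Replacing α by α' = 1 - n - α
-- turns the two α-dependent Pochhammer factors of the k-th summand into
--   (α' + t)_m      = (1 - m - (α - t + k))_m ,
--   (α' - t + k)_m  = (1 - m - (α + t))_m ,
-- and the reflection formula (a)_m = (-1)^m (b)_m, valid whenever
-- a + b + m = 1, shows that the product of the two is unchanged (the two
-- signs (-1)^m cancel).

open import Defs
open import Data.Nat using (ℕ; zero; suc; _∸_; _≤_; z≤n) renaming (_+_ to _+ℕ_)
open import Data.Nat.Properties using (m+[n∸m]≡n; m≤n⇒m≤1+n; ≤-refl)
open import Relation.Binary.PropositionalEquality using (subst)
import Algebra.Solver.Ring.NaturalCoefficients.Default as SemiringSolver
import Algebra.Properties.Ring as RingProperties
import Algebra.Properties.Group as GroupProperties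
import Relation.Binary.Reasoning.Setoid as SetoidReasoning

module PochhammerReflection {c ℓ} (F : CharZeroField c ℓ) where
  open CharZeroField F
  open SetoidReasoning setoid
  open RingProperties ring using (-‿distribˡ-*; -‿distribʳ-*; -‿involutive)
  open GroupProperties +-group using (identityʳ-unique; inverseˡ-unique; //-rightDividesˡ)
  -- Commutative-semiring normalisation; negated terms are treated as atoms.
  open SemiringSolver commutativeSemiring using (solve; _:=_; _:+_; _:*_; con)

  [_] : ℕ → Carrier
  [_] = ι commRing

  ι-+ : ∀ k m → [ k +ℕ m ] ≈ [ k ] + [ m ]
  ι-+ zero    m = sym (+-identityˡ [ m ])
  ι-+ (suc k) m = trans (+-cong refl (ι-+ k m)) (sym (+-assoc 1# [ k ] [ m ]))

  +-cancelling : ∀ w s → w + (s - s) ≈ w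
  +-cancelling w s = trans (+-cong refl (-‿inverseʳ s)) (+-identityʳ w)

  neg*neg : ∀ x y → - x * - y ≈ x * y
  neg*neg x y = begin
    - x * - y      ≈⟨ sym (-‿distribˡ-* x (- y)) ⟩
    - (x * - y)    ≈⟨ -‿cong (sym (-‿distribʳ-* x y)) ⟩
    - - (x * y)    ≈⟨ -‿involutive (x * y) ⟩
    x * y          ∎

  neg-swap : ∀ x y → - x * y ≈ x * - y
  neg-swap x y = trans (sym (-‿distribˡ-* x y)) (-‿distribʳ-* x y)

  sign : ℕ → Carrier
  sign zero    = 1#
  sign (suc m) = - sign m

  sign-square : ∀ m → sign m * sign m ≈ 1#
  sign-square zero    = *-identityˡ 1#
  sign-square (suc m) = trans (neg*neg (sign m) (sign m)) (sign-square m)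

  poch-suc : ∀ x m → poch x (suc m) ≈ x * poch (x + 1#) m
  poch-suc x zero = solve 2 (λ x o → o :* (x :+ con 0) := x :* o) refl x 1#
  poch-suc x (suc m) = begin
    poch x (suc m) * (x + [ suc m ])   ≈⟨ *-cong (poch-suc x m) refl ⟩
    x * Q * (x + (1# + [ m ]))         ≈⟨ solve 4 (λ x Q i o → x :* Q :* (x :+ (o :+ i))
                                                 := x :* (Q :* ((x :+ o) :+ i))) refl x Q [ m ] 1# ⟩
    x * (Q * ((x + 1#) + [ m ]))       ∎
    where Q = poch (x + 1#) m

  -- Reflection formula: (a)_m = (-1)^m (b)_m whenever a + b + m = 1,
  -- i.e. (a)_m = (-1)^m (1 - a - m)_m.  Induction on m, moving b to b + 1;
  -- the last factor a + m of (a)_{m+1} is then -b.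
  poch-reflect : ∀ m a b → a + b + [ m ] ≈ 1# → poch a m ≈ sign m * poch b m
  poch-reflect zero    a b _ = sym (*-identityˡ 1#)
  poch-reflect (suc m) a b a+b+m+1≈1 = begin
    poch a m * (a + [ m ])        ≈⟨ *-cong (poch-reflect m a (b + 1#) shifted) last-factor ⟩
    sign m * Q * - b              ≈⟨ solve 3 (λ s Q b′ → s :* Q :* b′ := s :* (b′ :* Q)) refl (sign m) Q (- b) ⟩
    sign m * (- b * Q)            ≈⟨ *-cong refl (sym (-‿distribˡ-* b Q)) ⟩
    sign m * - (b * Q)            ≈⟨ sym (neg-swap (sign m) (b * Q)) ⟩
    - sign m * (b * Q)            ≈⟨ *-cong refl (sym (poch-suc b m)) ⟩
    - sign m * poch b (suc m)     ∎
    where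
    Q = poch (b + 1#) m
    shifted : a + (b + 1#) + [ m ] ≈ 1#
    shifted = trans (solve 4 (λ a b i o → a :+ (b :+ o) :+ i := a :+ b :+ (o :+ i))
                       refl a b [ m ] 1#) a+b+m+1≈1
    last-factor : a + [ m ] ≈ - b
    last-factor = inverseˡ-unique _ b (identityʳ-unique 1# _ (begin
      1# + (a + [ m ] + b)     ≈⟨ solve 4 (λ a b i o → o :+ (a :+ i :+ b) := a :+ b :+ (o :+ i))
                                    refl a b [ m ] 1# ⟩
      a + b + [ suc m ]        ≈⟨ a+b+m+1≈1 ⟩
      1#                       ∎))

  poch-reflect-pair : ∀ m a b c d → a + d + [ m ] ≈ 1# → b + c + [ m ] ≈ 1# →
                      poch a m * poch b m ≈ poch c m * poch d m
  poch-reflect-pair m a b c d a+d+m≈1 b+c+m≈1 = begin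
    poch a m * poch b m                       ≈⟨ *-cong (poch-reflect m a d a+d+m≈1)
                                                        (poch-reflect m b c b+c+m≈1) ⟩
    sign m * poch d m * (sign m * poch c m)   ≈⟨ solve 3 (λ s D C → s :* D :* (s :* C) := s :* s :* (C :* D))
                                                   refl (sign m) (poch d m) (poch c m) ⟩
    sign m * sign m * (poch c m * poch d m)   ≈⟨ *-cong (sign-square m) refl ⟩
    1# * (poch c m * poch d m)                ≈⟨ *-identityˡ _ ⟩
    poch c m * poch d m                       ∎

  sumTo-cong : ∀ {f g} n → (∀ k → k ≤ n → f k ≈ g k) → sumTo f n ≈ sumTo g n
  sumTo-cong zero    f≈g = f≈g 0 z≤n
  sumTo-cong (suc n) f≈g =
    +-cong (sumTo-cong n (λ k k≤n → f≈g k (m≤n⇒m≤1+n k≤n))) (f≈g (suc n) ≤-refl)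

  summand : (ω α t : Carrier) (n k : ℕ) → Carrier
  summand ω α t n k = poch (ω * t) k * poch ((ω * ω) * t) k
                      * poch (α + t) (n ∸ k) * poch ((α - t) + [ k ]) (n ∸ k)
                      * (inv! k * inv! (n ∸ k))

  summand-reflect : ∀ ω α t n k → k ≤ n →
                    summand ω ((1# - [ n ]) - α) t n k ≈ summand ω α t n k
  summand-reflect ω α t n k k≤n = *-cong (begin
    X * A′ * C′      ≈⟨ *-assoc X A′ C′ ⟩
    X * (A′ * C′)    ≈⟨ *-cong refl (poch-reflect-pair m _ _ _ _ reflect₁ reflect₂) ⟩
    X * (A * C)      ≈⟨ sym (*-assoc X A C) ⟩
    X * A * C        ∎) refl
    where
    α′ = (1# - [ n ]) - α
    m = n ∸ k
    X = poch (ω * t) k * poch ((ω * ω) * t) k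
    A′ = poch (α′ + t) m
    C′ = poch ((α′ - t) + [ k ]) m
    A = poch (α + t) m
    C = poch ((α - t) + [ k ]) m

    α′+α+n≈1 : α′ + α + [ n ] ≈ 1#
    α′+α+n≈1 = trans (+-cong (//-rightDividesˡ α (1# - [ n ])) refl)
                     (//-rightDividesˡ [ n ] 1#)

    k+m≈n : [ k ] + [ m ] ≈ [ n ]
    k+m≈n = subst (λ j → [ k ] + [ m ] ≈ [ j ]) (m+[n∸m]≡n k≤n) (sym (ι-+ k m))

    complementary : ∀ u → u ≈ α′ + α + ([ k ] + [ m ]) + (t - t) → u ≈ 1#
    complementary u u≈ = begin
      u                                   ≈⟨ u≈ ⟩
      α′ + α + ([ k ] + [ m ]) + (t - t)  ≈⟨ +-cancelling _ t ⟩
      α′ + α + ([ k ] + [ m ])            ≈⟨ +-cong refl k+m≈n ⟩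
      α′ + α + [ n ]                      ≈⟨ α′+α+n≈1 ⟩
      1#                                  ∎

    reflect₁ : α′ + t + ((α - t) + [ k ]) + [ m ] ≈ 1#
    reflect₁ = complementary _
      (solve 6 (λ a′ a t t′ K M → a′ :+ t :+ ((a :+ t′) :+ K) :+ M := a′ :+ a :+ (K :+ M) :+ (t :+ t′))
         refl α′ α t (- t) [ k ] [ m ])

    reflect₂ : (α′ - t) + [ k ] + (α + t) + [ m ] ≈ 1#
    reflect₂ = complementary _
      (solve 6 (λ a′ a t t′ K M → (a′ :+ t′) :+ K :+ (a :+ t) :+ M := a′ :+ a :+ (K :+ M) :+ (t :+ t′))
         refl α′ α t (- t) [ k ] [ m ])

  B-reflect : ∀ ω n α t → B ω n ((1# - [ n ]) - α) t ≈ B ω n α t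
  B-reflect ω n α t = *-cong refl (sumTo-cong n (summand-reflect ω α t n))

-- Lemma 4.
lemma4 : ∀ {c ℓ} (F : CharZeroField c ℓ) → let open CharZeroField F in
    (ω : Carrier) → (ω * ω + ω + 1#) ≈ 0# →
    (n : ℕ) (α t : Carrier) →
    B ω n ((1# - ι commRing n) - α) t ≈ B ω n α t
lemma4 F ω _ = PochhammerReflection.B-reflect F ω
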